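{- For all integers $n\ge 2$ and $k\ge 2$, \[ GR_k(W_{2n}) \ge \begin{cases} (R_2(W_{2n})-1)\cdot 5^{(k-2)/2} + 1, & \text{if } k \text{ is even},\\ 2(R_2(W_{2n})-1)\cdot 5^{(k-3)/2} + 1, & \text{if } k \text{ is odd}. \end{cases} \]
   Context: A Gallai coloring of a complete graph is an edge-coloring with no rainbow triangle (a triangle whose three edges receive three distinct colors). A Gallai $k$-coloring is a Gallai coloring using at most $k$ colors. For a graph $H$ and integer $k\ge1$, the Gallai-Ramsey number $GR_k(H)$ is the least positive integer $N$ such that every Gallai $k$-coloring of the edges of $K_N$ contains a monochromatic copy of $H$. $R_2(H)$ is the classical 2-color Ramsey number: the least $N$ such that every 2-coloring of the edges of $K_N$ contains a monochromatic copy of $H$. $W_m$ denotes the wheel on $m+1$ vertices, i.e. a cycle $C_m$ plus one extra vertex adjacent to all vertices of the cycle. -}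

module Defs where

open import Data.Nat using (ℕ; zero; suc; _+_; _*_; _∸_; _^_; _≤_; _<_; _/_)
open import Data.Fin using (Fin; zero; suc; toℕ)
open import Data.Product using (Σ; ∃; _×_; _,_)
open import Data.Sum using (_⊎_)
open import Relation.Nullary using (¬_)
open import Relation.Binary.PropositionalEquality using (_≡_; _≢_)
open import Function.Definitions using (Injective)

-- An edge-colouring of the complete graph K_N with (at most) k colours:
-- a symmetric map on ordered pairs of vertices (the value on the diagonal is irrelevant).
record Coloring (N k : ℕ) : Set where
  field
    col  : Fin N → Fin N → Fin k
    symm : ∀ x y → col x y ≡ col y x
open Coloring public

Gallai : ∀ {N k} → Coloring N k → Set
Gallai {N} c = ∀ (x y z : Fin N) → x ≢ y → y ≢ z → x ≢ z →
  ¬ (col c x y ≢ col c y z × col c y z ≢ col c x z × col c x y ≢ col c x z)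

Graph : ℕ → Set₁
Graph v = Fin v → Fin v → Set

-- The wheel W_m on m+1 vertices: hub = zero, rim vertices suc i (i : Fin m)
-- forming the cycle 0 - 1 - ... - (m-1) - 0.
data WheelEdge (m : ℕ) : Fin (suc m) → Fin (suc m) → Set where
  spoke₁ : (i : Fin m) → WheelEdge m zero (suc i)
  spoke₂ : (i : Fin m) → WheelEdge m (suc i) zero
  rim₁   : (i j : Fin m) → (suc (toℕ i) ≡ toℕ j ⊎ (suc (toℕ i) ≡ m × toℕ j ≡ 0)) →
           WheelEdge m (suc i) (suc j)
  rim₂   : (i j : Fin m) → (suc (toℕ i) ≡ toℕ j ⊎ (suc (toℕ i) ≡ m × toℕ j ≡ 0)) →
           WheelEdge m (suc j) (suc i)

Wheel : (m : ℕ) → Graph (suc m)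
Wheel m = WheelEdge m

MonoCopy : ∀ {N k v} → Graph v → Coloring N k → Set
MonoCopy {N} {k} {v} H c =
  Σ (Fin v → Fin N) λ f → Injective _≡_ _≡_ f ×
    Σ (Fin k) λ a → ∀ u w → H u w → col c (f u) (f w) ≡ a

IsLeastPos : (ℕ → Set) → ℕ → Set
IsLeastPos P N = 1 ≤ N × P N × (∀ M → 1 ≤ M → M < N → ¬ P M)

GRArrow : ∀ {v} → ℕ → Graph v → ℕ → Set
GRArrow k H N = (c : Coloring N k) → Gallai c → MonoCopy H c

RArrow : ∀ {v} → Graph v → ℕ → Set
RArrow H N = (c : Coloring N 2) → MonoCopy H c

IsGR : ∀ {v} → ℕ → Graph v → ℕ → Set
IsGR k H = IsLeastPos (GRArrow k H)

IsR2 : ∀ {v} → Graph v → ℕ → Set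
IsR2 H = IsLeastPos (RArrow H)

-- Start from a 2-colouring of K_{R-1} without monochromatic W_{2n} and substitute it into a
-- base colouring B: vertex (x , i) is a copy of x in block i, edges inside a block keep their
-- old colour and edges between blocks i ≠ j get the fresh colour B i j. If B is Gallai, so is
-- the result. If moreover B has no monochromatic triangle, a monochromatic wheel cannot use a
-- fresh colour (hub and two adjacent rim vertices form a triangle), and in an old colour every
-- spoke stays inside the hub's block, so the wheel already lies in one copy of the original.
-- Substituting into the pentagon/pentagram colouring of K₅ adds two colours and multiplies the
-- number of vertices by 5; substituting into K₂ adds one colour and doubles it.
module Submission where

open import Defs
open import Data.Nat using (ℕ; suc; _+_; _*_; _∸_; _^_; _≤_; _≥_; _/_; _%_)
open import Relation.Binary.PropositionalEquality using (_≡_)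
open import Data.Product using (_×_)

open import Data.Nat using (zero; _≡ᵇ_; s≤s; z≤n)
open import Data.Nat.Properties using (+-comm; +-assoc; *-assoc; *-comm; *-identityʳ; +-identityʳ; ≰⇒>; n<1+n)
open import Data.Nat.DivMod using (m≡m%n+[m/n]*n; m*n/n≡m)
open import Data.Bool using (Bool; if_then_else_; _∨_)
open import Data.Bool.Properties using (∨-comm)
open import Data.Fin using (Fin; zero; suc; toℕ)
open import Data.Fin.Properties using (_≟_; all?; +↔⊎; *↔×; inject≤-injective)
open import Data.Product using (Σ; _,_; proj₁; proj₂)
open import Data.Product.Properties using (×-≡,≡→≡)
open import Data.Sum using (_⊎_; inj₁; inj₂)
open import Data.Empty using (⊥; ⊥-elim)
open import Function using (_∘_)
open import Function.Bundles using (_↣_; _↪_; mk↣; Injection; RightInverse)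
open import Function.Definitions using (Injective)
open import Function.Properties.Inverse using (↔-sym; ↔⇒↣; ↔⇒↪)
open import Relation.Binary.Definitions using (DecidableEquality)
open import Relation.Binary.PropositionalEquality
  using (_≢_; refl; sym; trans; cong; subst; subst₂; module ≡-Reasoning)
open import Relation.Nullary using (¬_; Dec; yes; no)
open import Relation.Nullary.Decidable using (¬?; _→-dec_; from-yes)

record EdgeColouring (V C : Set) : Set where
  field
    colour     : V → V → C
    colour-sym : ∀ x y → colour x y ≡ colour y x
open EdgeColouring

fromColoring : ∀ {N k} → Coloring N k → EdgeColouring (Fin N) (Fin k)
fromColoring c = record { colour = col c ; colour-sym = symm c }

toColoring : ∀ {N k} → EdgeColouring (Fin N) (Fin k) → Coloring N k
toColoring c = record { col = colour c ; symm = colour-sym c }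

Distinct₃ : {A : Set} → A → A → A → Set
Distinct₃ a b d = a ≢ b × b ≢ d × a ≢ d

IsGallai : ∀ {V C} → EdgeColouring V C → Set
IsGallai {V} c = ∀ (x y z : V) → x ≢ y → y ≢ z → x ≢ z →
  ¬ Distinct₃ (colour c x y) (colour c y z) (colour c x z)

NoMonoTriangle : ∀ {V C} → EdgeColouring V C → Set
NoMonoTriangle {V} c = ∀ (x y z : V) → x ≢ y → y ≢ z → x ≢ z →
  colour c x y ≡ colour c y z → colour c x y ≡ colour c x z → ⊥

HasMonoCopy : ∀ {v V C} → Graph v → EdgeColouring V C → Set
HasMonoCopy {v} {V} {C} H c =
  Σ (Fin v → V) λ f → Injective _≡_ _≡_ f ×
    Σ C λ a → ∀ u w → H u w → colour c (f u) (f w) ≡ a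

distinct₃-map : ∀ {A B : Set} (f : A → B) {a b d : A} →
  Distinct₃ (f a) (f b) (f d) → Distinct₃ a b d
distinct₃-map f (fa≢fb , fb≢fd , fa≢fd) =
  fa≢fb ∘ cong f , fb≢fd ∘ cong f , fa≢fd ∘ cong f

fin2-¬distinct₃ : (a b d : Fin 2) → ¬ Distinct₃ a b d
fin2-¬distinct₃ zero       zero       _          (a≢b , _)     = a≢b refl
fin2-¬distinct₃ (suc zero) (suc zero) _          (a≢b , _)     = a≢b refl
fin2-¬distinct₃ zero       (suc zero) zero       (_ , _ , a≢d) = a≢d refl
fin2-¬distinct₃ zero       (suc zero) (suc zero) (_ , b≢d , _) = b≢d refl
fin2-¬distinct₃ (suc zero) zero       zero       (_ , b≢d , _) = b≢d refl
fin2-¬distinct₃ (suc zero) zero       (suc zero) (_ , _ , a≢d) = a≢d refl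

twoColouring-gallai : ∀ {V} (c : EdgeColouring V (Fin 2)) → IsGallai c
twoColouring-gallai c _ _ _ _ _ _ = fin2-¬distinct₃ _ _ _

module _ {V W C : Set} (g : W ↣ V) (c : EdgeColouring V C) where
  open Injection g using (to; injective)

  pullback : EdgeColouring W C
  pullback = record
    { colour     = λ x y → colour c (to x) (to y)
    ; colour-sym = λ x y → colour-sym c (to x) (to y)
    }

  pullback-gallai : IsGallai c → IsGallai pullback
  pullback-gallai gallai x y z x≢y y≢z x≢z =
    gallai (to x) (to y) (to z) (x≢y ∘ injective) (y≢z ∘ injective) (x≢z ∘ injective)

  pullback-monoCopy : ∀ {v} {H : Graph v} → HasMonoCopy H pullback → HasMonoCopy H c
  pullback-monoCopy (f , f-injective , a , mono) = to ∘ f , f-injective ∘ injective , a , mono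

module _ {V C D : Set} (e : C ↪ D) (c : EdgeColouring V C) where
  open RightInverse e using (to; from; strictlyInverseʳ)

  recolour : EdgeColouring V D
  recolour = record
    { colour     = λ x y → to (colour c x y)
    ; colour-sym = λ x y → cong to (colour-sym c x y)
    }

  recolour-gallai : IsGallai c → IsGallai recolour
  recolour-gallai gallai x y z x≢y y≢z x≢z = gallai x y z x≢y y≢z x≢z ∘ distinct₃-map to

  recolour-monoCopy : ∀ {v} {H : Graph v} → HasMonoCopy H recolour → HasMonoCopy H c
  recolour-monoCopy (f , f-injective , a , mono) =
    f , f-injective , from a ,
    λ u w uw → trans (sym (strictlyInverseʳ (colour c (f u) (f w)))) (cong from (mono u w uw))

module Substitution {V P C D : Set} (_≟ᴾ_ : DecidableEquality P)
                    (B : EdgeColouring P C) (c : EdgeColouring V D) where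

  substituted : V × P → V × P → D ⊎ C
  substituted (x , i) (y , j) with i ≟ᴾ j
  ... | yes _ = inj₁ (colour c x y)
  ... | no  _ = inj₂ (colour B i j)

  substituted-inside : ∀ i x y → substituted (x , i) (y , i) ≡ inj₁ (colour c x y)
  substituted-inside i x y with i ≟ᴾ i
  ... | yes _  = refl
  ... | no i≢i = ⊥-elim (i≢i refl)

  substituted-across : ∀ {i j} x y → i ≢ j → substituted (x , i) (y , j) ≡ inj₂ (colour B i j)
  substituted-across {i} {j} x y i≢j with i ≟ᴾ j
  ... | yes i≡j = ⊥-elim (i≢j i≡j)
  ... | no  _   = refl

  substituted-old : ∀ X Y {b} → substituted X Y ≡ inj₁ b →
    proj₂ X ≡ proj₂ Y × colour c (proj₁ X) (proj₁ Y) ≡ b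
  substituted-old (x , i) (y , j) eq with i ≟ᴾ j | eq
  ... | yes i≡j | refl = i≡j , refl

  substituted-new : ∀ X Y {a} → substituted X Y ≡ inj₂ a →
    proj₂ X ≢ proj₂ Y × colour B (proj₂ X) (proj₂ Y) ≡ a
  substituted-new (x , i) (y , j) eq with i ≟ᴾ j | eq
  ... | no i≢j | refl = i≢j , refl

  substituted-sym : ∀ X Y → substituted X Y ≡ substituted Y X
  substituted-sym (x , i) (y , j) with i ≟ᴾ j
  ... | yes refl rewrite substituted-inside i y x = cong inj₁ (colour-sym c x y)
  ... | no  i≢j  rewrite substituted-across y x (i≢j ∘ sym) = cong inj₂ (colour-sym B i j)

  substitute : EdgeColouring (V × P) (D ⊎ C)
  substitute = record { colour = substituted ; colour-sym = substituted-sym }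

  -- A triangle meeting two blocks has two edges across, and these carry the same colour.
  substitute-gallai : IsGallai B → IsGallai c → IsGallai substitute
  substitute-gallai gallaiB gallaic (x , i) (y , j) (z , l) = byBlocks (i ≟ᴾ j) (j ≟ᴾ l) (i ≟ᴾ l)
    where
    byBlocks : ∀ {i j l} → Dec (i ≡ j) → Dec (j ≡ l) → Dec (i ≡ l) →
      (x , i) ≢ (y , j) → (y , j) ≢ (z , l) → (x , i) ≢ (z , l) →
      ¬ Distinct₃ (substituted (x , i) (y , j)) (substituted (y , j) (z , l)) (substituted (x , i) (z , l))
    byBlocks {i} (yes refl) (yes refl) _ X≢Y Y≢Z X≢Z
      rewrite substituted-inside i x y | substituted-inside i y z | substituted-inside i x z =
        gallaic x y z (X≢Y ∘ cong (_, i)) (Y≢Z ∘ cong (_, i)) (X≢Z ∘ cong (_, i)) ∘ distinct₃-map inj₁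
    byBlocks (yes refl) (no i≢l) _ _ _ _
      rewrite substituted-across y z i≢l | substituted-across x z i≢l = λ (_ , b≢d , _) → b≢d refl
    byBlocks (no i≢j) (yes refl) _ _ _ _
      rewrite substituted-across x y i≢j | substituted-across x z i≢j = λ (_ , _ , a≢d) → a≢d refl
    byBlocks {i} {j} (no i≢j) (no j≢i) (yes refl) _ _ _
      rewrite substituted-across x y i≢j | substituted-across y z j≢i | colour-sym B j i =
        λ (a≢b , _) → a≢b refl
    byBlocks {i} {j} {l} (no i≢j) (no j≢l) (no i≢l) _ _ _
      rewrite substituted-across x y i≢j | substituted-across y z j≢l | substituted-across x z i≢l =
        gallaiB i j l i≢j j≢l i≢l ∘ distinct₃-map inj₂

  noFreshTriangle : NoMonoTriangle B → ∀ X Y Z {a} →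
    substituted X Y ≡ inj₂ a → substituted Y Z ≡ inj₂ a → substituted X Z ≡ inj₂ a → ⊥
  noFreshTriangle noTriangle X Y Z XY YZ XZ
    with substituted-new X Y XY | substituted-new Y Z YZ | substituted-new X Z XZ
  ... | X≢Y , refl | Y≢Z , YZ≡ | X≢Z , XZ≡ = noTriangle _ _ _ X≢Y Y≢Z X≢Z (sym YZ≡) (sym XZ≡)

  substitute-monoWheel : ∀ {m} → NoMonoTriangle B →
    HasMonoCopy (Wheel (suc (suc m))) substitute → HasMonoCopy (Wheel (suc (suc m))) c
  substitute-monoWheel noTriangle (f , f-injective , inj₁ b , mono) =
    proj₁ ∘ f , injective , b , λ u w uw → proj₂ (substituted-old (f u) (f w) (mono u w uw))
    where
    inHubBlock : ∀ u → proj₂ (f u) ≡ proj₂ (f zero)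
    inHubBlock zero    = refl
    inHubBlock (suc i) = sym (proj₁ (substituted-old (f zero) (f (suc i)) (mono zero (suc i) (spoke₁ i))))

    injective : Injective _≡_ _≡_ (proj₁ ∘ f)
    injective {u} {w} fu≡fw = f-injective (×-≡,≡→≡ (fu≡fw , trans (inHubBlock u) (sym (inHubBlock w))))
  substitute-monoWheel noTriangle (f , _ , inj₂ _ , mono) =
    ⊥-elim (noFreshTriangle noTriangle (f zero) (f (suc zero)) (f (suc (suc zero)))
      (mono _ _ (spoke₁ zero)) (mono _ _ (rim₁ zero (suc zero) (inj₁ refl))) (mono _ _ (spoke₁ (suc zero))))

open Substitution using (substitute; substitute-gallai; substitute-monoWheel)

-- Rather than a colouring without monochromatic H (which the minimality of R does not
-- constructively provide), every 2-colouring c₀ is lifted and monochromatic copies are pulled back.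
record GallaiLift {v} (H : Graph v) {V₀ C₀ : Set} (c₀ : EdgeColouring V₀ C₀) (N k : ℕ) : Set where
  field
    colouring         : EdgeColouring (Fin N) (Fin k)
    gallai            : IsGallai colouring
    reflects-monoCopy : HasMonoCopy H colouring → HasMonoCopy H c₀
open GallaiLift

gallaiLift-shrink : ∀ {v} {H : Graph v} {V₀ C₀} {c₀ : EdgeColouring V₀ C₀} {M N k} →
  M ≤ N → GallaiLift H c₀ N k → GallaiLift H c₀ M k
gallaiLift-shrink {M = M} {N} M≤N L = record
  { colouring         = pullback embed (colouring L)
  ; gallai            = pullback-gallai embed (colouring L) (gallai L)
  ; reflects-monoCopy = reflects-monoCopy L ∘ pullback-monoCopy embed (colouring L)
  }
  where
  embed : Fin M ↣ Fin N
  embed = mk↣ (inject≤-injective M≤N M≤N _ _)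

gallaiLift-refl : ∀ {v} {H : Graph v} {N k} {c₀ : EdgeColouring (Fin N) (Fin k)} →
  IsGallai c₀ → GallaiLift H c₀ N k
gallaiLift-refl {c₀ = c₀} gallai₀ = record
  { colouring = c₀ ; gallai = gallai₀ ; reflects-monoCopy = λ copy → copy }

gallaiLift-substitute : ∀ {m p q N k V₀ C₀} {c₀ : EdgeColouring V₀ C₀}
  (B : EdgeColouring (Fin p) (Fin q)) → IsGallai B → NoMonoTriangle B →
  GallaiLift (Wheel (suc (suc m))) c₀ N k → GallaiLift (Wheel (suc (suc m))) c₀ (N * p) (k + q)
gallaiLift-substitute {p = p} {q} {N} {k} B gallaiB noTriangle L = record
  { colouring         = recolour join pulled
  ; gallai            = recolour-gallai join pulled (pullback-gallai split substituted
                          (substitute-gallai _≟_ B (colouring L) gallaiB (gallai L)))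
  ; reflects-monoCopy = reflects-monoCopy L ∘ substitute-monoWheel _≟_ B (colouring L) noTriangle
                          ∘ pullback-monoCopy split substituted ∘ recolour-monoCopy join pulled
  }
  where
  substituted : EdgeColouring (Fin N × Fin p) (Fin k ⊎ Fin q)
  substituted = substitute _≟_ B (colouring L)

  split : Fin (N * p) ↣ (Fin N × Fin p)
  split = ↔⇒↣ *↔×

  pulled : EdgeColouring (Fin (N * p)) (Fin k ⊎ Fin q)
  pulled = pullback split substituted

  join : (Fin k ⊎ Fin q) ↪ Fin (k + q)
  join = ↔⇒↪ (↔-sym +↔⊎)

pentagon : EdgeColouring (Fin 5) (Fin 2)
pentagon = record
  { colour     = λ i j → if onCycle i j then zero else suc zero
  ; colour-sym = λ i j → cong (if_then zero else suc zero) (∨-comm (i ↦ j) (j ↦ i))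
  }
  where
  _↦_ : Fin 5 → Fin 5 → Bool
  i ↦ j = (suc (toℕ i) % 5) ≡ᵇ toℕ j

  onCycle : Fin 5 → Fin 5 → Bool
  onCycle i j = (i ↦ j) ∨ (j ↦ i)

pentagon-noMonoTriangle : NoMonoTriangle pentagon
pentagon-noMonoTriangle = from-yes (all? λ x → all? λ y → all? λ z →
  ¬? (x ≟ y) →-dec ¬? (y ≟ z) →-dec ¬? (x ≟ z) →-dec
  (colour pentagon x y ≟ colour pentagon y z) →-dec
  (colour pentagon x y ≟ colour pentagon x z) →-dec no λ ())

monoEdge : EdgeColouring (Fin 2) (Fin 1)
monoEdge = record { colour = λ _ _ → zero ; colour-sym = λ _ _ → refl }

monoEdge-gallai : IsGallai monoEdge
monoEdge-gallai _ _ _ _ _ _ (a≢b , _) = a≢b refl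

monoEdge-noMonoTriangle : NoMonoTriangle monoEdge
monoEdge-noMonoTriangle x y z x≢y y≢z x≢z _ _ = fin2-¬distinct₃ x y z (x≢y , y≢z , x≢z)

gallaiLift-pentagons : ∀ {m N k V₀ C₀} {c₀ : EdgeColouring V₀ C₀} j →
  GallaiLift (Wheel (suc (suc m))) c₀ N k → GallaiLift (Wheel (suc (suc m))) c₀ (N * 5 ^ j) (k + j * 2)
gallaiLift-pentagons {N = N} {k} zero L =
  subst₂ (GallaiLift _ _) (sym (*-identityʳ N)) (sym (+-identityʳ k)) L
gallaiLift-pentagons {N = N} {k} (suc j) L =
  subst₂ (GallaiLift _ _) (*-assoc N 5 (5 ^ j)) (+-assoc k 2 (j * 2))
    (gallaiLift-pentagons j
      (gallaiLift-substitute pentagon (twoColouring-gallai pentagon) pentagon-noMonoTriangle L))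

least-pred-fails : ∀ {P : ℕ → Set} {N} → IsLeastPos P N → ¬ P 0 → ¬ P (N ∸ 1)
least-pred-fails {N = suc zero}    _               ¬P0 = ¬P0
least-pred-fails {N = suc (suc n)} (_ , _ , least) _   = least (suc n) (s≤s z≤n) (n<1+n (suc n))

¬RArrow-zero : ∀ {v} (H : Graph (suc v)) → ¬ RArrow H 0
¬RArrow-zero H arrow with proj₁ (arrow (record { col = λ () ; symm = λ () })) zero
... | ()

gallaiLift-monoCopy : ∀ {v k N} {H : Graph v} {V₀ C₀} {c₀ : EdgeColouring V₀ C₀} →
  GRArrow k H N → GallaiLift H c₀ N k → HasMonoCopy H c₀
gallaiLift-monoCopy arrow L = reflects-monoCopy L (arrow (toColoring (colouring L)) (gallai L))

gallaiLift-lowerBound : ∀ {v k G R N} {H : Graph (suc v)} → IsGR k H G → IsR2 H R →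
  (∀ (c₀ : Coloring (R ∸ 1) 2) → GallaiLift H (fromColoring c₀) N k) → G ≥ N + 1
gallaiLift-lowerBound {G = G} {N = N} {H} (_ , arrow , _) isR2 lift =
  subst (_≤ G) (+-comm 1 N) (≰⇒> λ G≤N → least-pred-fails isR2 (¬RArrow-zero H) λ c₀ →
    gallaiLift-monoCopy arrow (gallaiLift-shrink G≤N (lift c₀)))

even-half : ∀ {k} → k % 2 ≡ 0 → k / 2 * 2 ≡ k
even-half {k} k%2≡0 = sym (trans (m≡m%n+[m/n]*n k 2) (cong (_+ k / 2 * 2) k%2≡0))

odd-half : ∀ {k} → k % 2 ≡ 1 → suc ((k ∸ 1) / 2 * 2) ≡ k
odd-half {k} k%2≡1 = begin
  suc ((k ∸ 1) / 2 * 2)           ≡⟨ cong (λ t → suc ((t ∸ 1) / 2 * 2)) k≡1+[k/2]*2 ⟩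
  suc (k / 2 * 2 / 2 * 2)         ≡⟨ cong (λ t → suc (t * 2)) (m*n/n≡m (k / 2) 2) ⟩
  suc (k / 2 * 2)                 ≡⟨ sym k≡1+[k/2]*2 ⟩
  k                               ∎
  where
  open ≡-Reasoning
  k≡1+[k/2]*2 : k ≡ 1 + k / 2 * 2
  k≡1+[k/2]*2 = trans (m≡m%n+[m/n]*n k 2) (cong (_+ k / 2 * 2) k%2≡1)

proposition1p4 : ∀ (n k : ℕ) → n ≥ 2 → k ≥ 2 → ∀ (G R : ℕ) →
    IsGR k (Wheel (2 * n)) G → IsR2 (Wheel (2 * n)) R →
    (k % 2 ≡ 0 → G ≥ (R ∸ 1) * 5 ^ ((k ∸ 2) / 2) + 1) ×
    (k % 2 ≡ 1 → G ≥ 2 * (R ∸ 1) * 5 ^ ((k ∸ 3) / 2) + 1)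
proposition1p4 (suc (suc n)) (suc (suc k)) (s≤s (s≤s z≤n)) (s≤s (s≤s z≤n)) G R isGR isR2 = even , odd
  where
  even : k % 2 ≡ 0 → G ≥ (R ∸ 1) * 5 ^ (k / 2) + 1
  even k-even = gallaiLift-lowerBound isGR isR2 λ c₀ →
    subst (GallaiLift _ _ _) (cong (2 +_) (even-half k-even))
      (gallaiLift-pentagons (k / 2) (gallaiLift-refl (twoColouring-gallai (fromColoring c₀))))

  odd : k % 2 ≡ 1 → G ≥ 2 * (R ∸ 1) * 5 ^ ((k ∸ 1) / 2) + 1
  odd k-odd = gallaiLift-lowerBound isGR isR2 λ c₀ →
    subst₂ (GallaiLift _ _) (cong (_* 5 ^ ((k ∸ 1) / 2)) (*-comm (R ∸ 1) 2)) (cong (2 +_) (odd-half k-odd))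
      (gallaiLift-pentagons ((k ∸ 1) / 2)
        (gallaiLift-substitute monoEdge monoEdge-gallai monoEdge-noMonoTriangle
          (gallaiLift-refl (twoColouring-gallai (fromColoring c₀)))))
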